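{- There is an absolute constant $c_0>0$ such that for every $k\in\mathbb{N}$ there is an undirected quasi-bipartite graph $G$ with $k$ terminals such that every vertex-cut sparsifier of $G$ that is a subgraph of $G$ has at least $c_0 k^2$ vertices.
   Context: Graphs are unweighted and undirected. For vertex sets $A,B\subseteq V$ of $G=(V,E)$, an $(A,B)$-vertex-cut is a set $C\subseteq V$ (which may intersect $A\cup B$) such that for all $a\in A\setminus C$ and $b\in B\setminus C$ there is no path from $a$ to $b$ in $G\setminus C$; $\mathrm{mincut}_G(A,B)$ is the minimum size of an $(A,B)$-vertex-cut. A vertex-cut sparsifier of $G$ with respect to terminals $T\subseteq V$ is a graph $G'=(V',E')$ with $T\subseteq V'$ such that $\mathrm{mincut}_G(A,B)=\mathrm{mincut}_{G'}(A,B)$ for all $A,B\subseteq T$. A graph with terminal set $T$ is quasi-bipartite if every edge has at least one endpoint in $T$. -}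

module Defs where

open import Data.Nat using (ℕ; _≤_)
open import Data.Bool using (Bool; true; false)
open import Data.Fin using (Fin)
open import Data.Fin.Subset using (Subset; _∈_; _∉_; _⊆_; ⊤; ∣_∣)
open import Data.Product using (Σ; ∃; ∃-syntax; _×_; _,_)
open import Data.Sum using (_⊎_)
open import Relation.Binary.PropositionalEquality using (_≡_)
open import Relation.Nullary using (¬_)
open import Function.Bundles using (_⇔_)

Edges : ℕ → Set
Edges n = Fin n → Fin n → Bool

record IsSimpleUndirected {n : ℕ} (E : Edges n) : Set where
  field
    sym     : ∀ u v → E u v ≡ true → E v u ≡ true
    irrefl  : ∀ u → E u u ≡ false

QuasiBipartite : {n : ℕ} → Edges n → Subset n → Set
QuasiBipartite E T = ∀ u v → E u v ≡ true → (u ∈ T) ⊎ (v ∈ T)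

data PathAvoiding {n : ℕ} (E : Edges n) (C : Subset n) : Fin n → Fin n → Set where
  here : ∀ {a} → a ∉ C → PathAvoiding E C a a
  step : ∀ {a b c} → a ∉ C → E a b ≡ true → PathAvoiding E C b c → PathAvoiding E C a c

IsVertexCut : {n : ℕ} → Subset n → Edges n → Subset n → Subset n → Subset n → Set
IsVertexCut V E A B C =
  C ⊆ V × (∀ a b → a ∈ A → a ∉ C → b ∈ B → b ∉ C → ¬ PathAvoiding E C a b)

IsMinCut : {n : ℕ} → Subset n → Edges n → Subset n → Subset n → ℕ → Set
IsMinCut V E A B m =
  (∃[ C ] (IsVertexCut V E A B C × ∣ C ∣ ≡ m))
  × (∀ C → IsVertexCut V E A B C → m ≤ ∣ C ∣)

record Subgraph {n : ℕ} (E : Edges n) : Set where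
  field
    V'      : Subset n
    E'      : Edges n
    E'⊆E    : ∀ u v → E' u v ≡ true → E u v ≡ true
    E'-endl : ∀ u v → E' u v ≡ true → u ∈ V'
    E'-endr : ∀ u v → E' u v ≡ true → v ∈ V'
    E'-sym  : ∀ u v → E' u v ≡ true → E' v u ≡ true
open Subgraph public

IsVertexCutSparsifier : {n : ℕ} (E : Edges n) → Subset n → Subgraph E → Set
IsVertexCutSparsifier E T H =
  T ⊆ V' H ×
  (∀ A B → A ⊆ T → B ⊆ T → ∀ m →
     IsMinCut ⊤ E A B m ⇔ IsMinCut (V' H) (E' H) A B m)

-- The hard instance is the complete bipartite graph K_{a,b}, a + b = k, with every edge subdivided:
-- terminals L i and R j, and one non-terminal M i j on each subdivided edge. For A = T - R j and
-- B = T - L i every cut contains A ∩ B and must also hit the path L i – M i j – R j, so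
-- mincut(A, B) = |A ∩ B| + 1; in a subgraph missing M i j, however, A ∩ B alone separates L i from
-- R j. Hence a subgraph sparsifier keeps all k + ab ≥ k²/4 vertices.
module Submission where

open import Data.Bool using (true)
open import Data.Empty using (⊥-elim)
open import Data.Fin using (Fin; zero; suc; _↑ˡ_; _↑ʳ_; splitAt; join; combine; remQuot)
open import Data.Fin.Properties
  using (_≟_; splitAt-↑ˡ; splitAt-↑ʳ; splitAt-join; join-splitAt; remQuot-combine; combine-remQuot)
open import Data.Fin.Subset using (Subset; _∈_; _∉_; _⊆_; _⊂_; ⊤; ⊥; ∣_∣; _-_; inside; outside)
open import Data.Fin.Subset.Properties
  using (_∈?_; ∈⊤; ∣⊤∣≡n; p⊆q⇒∣p∣≤∣q∣; ∣⊥∣≡0; p─⊥≡p; p─q⊆p; p⊂q⇒∣p∣<∣q∣; x∈p⇒∣p-x∣<∣p∣; x∈p∧x≢y⇒x∈p-y)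
open import Data.Nat using (ℕ; zero; suc; _+_; _*_; _≤_; _>_; z≤n; s≤s)
open import Data.Nat.Properties
  using (≤-reflexive; ≤-trans; n≤1+n; m≤m+n; +-suc; +-identityʳ; *-monoʳ-≤; <⇒≱)
open import Data.Nat.Solver using (module +-*-Solver)
open import Data.Product using (Σ; ∃-syntax; _×_; _,_; proj₁; proj₂)
open import Data.Sum using (_⊎_; inj₁; inj₂)
import Data.Sum as Sum
open import Data.Vec using (_∷_; _++_; there)
open import Data.Vec.Properties using ([]=⇒lookup; lookup⇒[]=; lookup-++ˡ; lookup-++ʳ; lookup-replicate)
open import Function.Bundles using (Equivalence)
open import Relation.Binary.Definitions using (Decidable)
open import Relation.Binary.PropositionalEquality
  using (_≡_; _≢_; refl; sym; trans; cong; subst; subst₂)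
open import Relation.Nullary using (¬_; Dec; yes; no; does)
open import Relation.Nullary.Decidable using (dec-true; dec-false)

open import Defs

x∈p-y⇒x≢y : ∀ {n} {p : Subset n} {x y} → x ∈ p - y → x ≢ y
x∈p-y⇒x≢y {p = _ ∷ _} {zero} () refl
x∈p-y⇒x≢y {p = _ ∷ _} {suc _} (there x∈p-y) refl = x∈p-y⇒x≢y x∈p-y refl

∣p∣≤1+∣p-x∣ : ∀ {n} (p : Subset n) x → ∣ p ∣ ≤ suc ∣ p - x ∣
∣p∣≤1+∣p-x∣ (inside  ∷ p) zero    = s≤s (≤-reflexive (cong ∣_∣ (sym (p─⊥≡p p))))
∣p∣≤1+∣p-x∣ (outside ∷ p) zero    = ≤-trans (≤-reflexive (cong ∣_∣ (sym (p─⊥≡p p)))) (n≤1+n _)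
∣p∣≤1+∣p-x∣ (inside  ∷ p) (suc x) = s≤s (∣p∣≤1+∣p-x∣ p x)
∣p∣≤1+∣p-x∣ (outside ∷ p) (suc x) = ∣p∣≤1+∣p-x∣ p x

∣⊤++p∣ : ∀ m {n} (p : Subset n) → ∣ ⊤ {m} ++ p ∣ ≡ m + ∣ p ∣
∣⊤++p∣ zero    p = refl
∣⊤++p∣ (suc m) p = cong suc (∣⊤++p∣ m p)

does-true⇒ : ∀ {p} {P : Set p} (P? : Dec P) → does P? ≡ true → P
does-true⇒ (yes p) _ = p

module _ {n} {E : Edges n} {C : Subset n} where

  source∉ : ∀ {x y} → PathAvoiding E C x y → x ∉ C
  source∉ (here x∉C)     = x∉C
  source∉ (step x∉C _ _) = x∉C

  PathAvoiding-preserves : (P : Fin n → Set) →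
                           (∀ {x z} → P x → E x z ≡ true → z ∉ C → P z) →
                           ∀ {x y} → P x → PathAvoiding E C x y → P y
  PathAvoiding-preserves P closed Px (here _)     = Px
  PathAvoiding-preserves P closed Px (step _ e p) =
    PathAvoiding-preserves P closed (closed Px e (source∉ p)) p

∩⊆cut : ∀ {n} {V : Subset n} {E A B C x} → IsVertexCut V E A B C → x ∈ A → x ∈ B → x ∈ C
∩⊆cut {C = C} {x} (_ , separates) x∈A x∈B with x ∈? C
... | yes x∈C = x∈C
... | no  x∉C = ⊥-elim (separates x x x∈A x∉C x∈B x∉C (here x∉C))

sparsifier-mincut≤cut : ∀ {n} {E : Edges n} {T H A B C m} → IsVertexCutSparsifier E T H →
                        A ⊆ T → B ⊆ T → IsMinCut ⊤ E A B m →
                        IsVertexCut (V' H) (E' H) A B C → m ≤ ∣ C ∣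
sparsifier-mincut≤cut (_ , preserves) A⊆T B⊆T minG cutH =
  proj₂ (Equivalence.to (preserves _ _ A⊆T B⊆T _) minG) _ cutH

module SubdividedBiclique (a b : ℕ) where

  Vertex : Set
  Vertex = (Fin a ⊎ Fin b) ⊎ (Fin a × Fin b)

  pattern left  i   = inj₁ (inj₁ i)
  pattern right j   = inj₁ (inj₂ j)
  pattern mid   i j = inj₂ (i , j)

  size : ℕ
  size = (a + b) + a * b

  kind : Fin size → Vertex
  kind x = Sum.map (splitAt a) (remQuot b) (splitAt (a + b) x)

  vertexAt : Vertex → Fin size
  vertexAt (inj₁ u)  = join a b u ↑ˡ (a * b)
  vertexAt (mid i j) = (a + b) ↑ʳ combine i j

  kind-vertexAt : ∀ v → kind (vertexAt v) ≡ v
  kind-vertexAt (inj₁ u) rewrite splitAt-↑ˡ (a + b) (join a b u) (a * b) =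
    cong inj₁ (splitAt-join a b u)
  kind-vertexAt (mid i j) rewrite splitAt-↑ʳ (a + b) (a * b) (combine i j) =
    cong inj₂ (remQuot-combine i j)

  vertexAt-kind : ∀ x → vertexAt (kind x) ≡ x
  vertexAt-kind x = trans (vertexAt-map (splitAt (a + b) x)) (join-splitAt (a + b) (a * b) x)
    where vertexAt-map : ∀ s → vertexAt (Sum.map (splitAt a) (remQuot b) s) ≡ join (a + b) (a * b) s
          vertexAt-map (inj₁ y) = cong (_↑ˡ (a * b)) (join-splitAt a b y)
          vertexAt-map (inj₂ p) = cong ((a + b) ↑ʳ_) (combine-remQuot {a} b p)

  vertexAt-injective : ∀ {u v} → vertexAt u ≡ vertexAt v → u ≡ v
  vertexAt-injective {u} {v} eq = trans (sym (kind-vertexAt u)) (trans (cong kind eq) (kind-vertexAt v))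

  kind≡⇒≡vertexAt : ∀ {x v} → kind x ≡ v → x ≡ vertexAt v
  kind≡⇒≡vertexAt {x} refl = sym (vertexAt-kind x)

  L : Fin a → Fin size
  L i = vertexAt (left i)

  R : Fin b → Fin size
  R j = vertexAt (right j)

  M : Fin a → Fin b → Fin size
  M i j = vertexAt (mid i j)

  L≢R : ∀ {i j} → L i ≢ R j
  L≢R {i} {j} eq with vertexAt-injective {left i} {right j} eq
  ... | ()

  R-injective : ∀ {j j′} → R j ≡ R j′ → j ≡ j′
  R-injective {j} {j′} eq with vertexAt-injective {right j} {right j′} eq
  ... | refl = refl

  data Adjacent : Vertex → Vertex → Set where
    left-mid  : ∀ i j → Adjacent (left i) (mid i j)
    mid-left  : ∀ i j → Adjacent (mid i j) (left i)
    right-mid : ∀ i j → Adjacent (right j) (mid i j)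
    mid-right : ∀ i j → Adjacent (mid i j) (right j)

  adjacent? : Decidable Adjacent
  adjacent? (left i)  (mid i′ j) with i ≟ i′
  ... | yes refl = yes (left-mid i j)
  ... | no  i≢i′ = no λ { (left-mid _ _) → i≢i′ refl }
  adjacent? (mid i j) (left i′) with i ≟ i′
  ... | yes refl = yes (mid-left i j)
  ... | no  i≢i′ = no λ { (mid-left _ _) → i≢i′ refl }
  adjacent? (right j) (mid i j′) with j ≟ j′
  ... | yes refl = yes (right-mid i j)
  ... | no  j≢j′ = no λ { (right-mid _ _) → j≢j′ refl }
  adjacent? (mid i j) (right j′) with j ≟ j′
  ... | yes refl = yes (mid-right i j)
  ... | no  j≢j′ = no λ { (mid-right _ _) → j≢j′ refl }
  adjacent? (left _)  (left _)  = no λ ()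
  adjacent? (left _)  (right _) = no λ ()
  adjacent? (right _) (left _)  = no λ ()
  adjacent? (right _) (right _) = no λ ()
  adjacent? (mid _ _) (mid _ _) = no λ ()

  Adjacent-sym : ∀ {u v} → Adjacent u v → Adjacent v u
  Adjacent-sym (left-mid i j)  = mid-left i j
  Adjacent-sym (mid-left i j)  = left-mid i j
  Adjacent-sym (right-mid i j) = mid-right i j
  Adjacent-sym (mid-right i j) = right-mid i j

  Adjacent-irrefl : ∀ {v} → ¬ Adjacent v v
  Adjacent-irrefl ()

  Adjacent-terminal : ∀ {u v} → Adjacent u v → (∃[ w ] u ≡ inj₁ w) ⊎ (∃[ w ] v ≡ inj₁ w)
  Adjacent-terminal (left-mid i j)  = inj₁ (inj₁ i , refl)
  Adjacent-terminal (mid-left i j)  = inj₂ (inj₁ i , refl)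
  Adjacent-terminal (right-mid i j) = inj₁ (inj₂ j , refl)
  Adjacent-terminal (mid-right i j) = inj₂ (inj₂ j , refl)

  Adjacent-left : ∀ {i v} → Adjacent (left i) v → ∃[ j ] v ≡ mid i j
  Adjacent-left (left-mid i j) = j , refl

  Adjacent-mid : ∀ {i j v} → Adjacent (mid i j) v → v ≡ left i ⊎ v ≡ right j
  Adjacent-mid (mid-left i j)  = inj₁ refl
  Adjacent-mid (mid-right i j) = inj₂ refl

  E : Edges size
  E x y = does (adjacent? (kind x) (kind y))

  E⇒Adjacent : ∀ {x y} → E x y ≡ true → Adjacent (kind x) (kind y)
  E⇒Adjacent {x} {y} = does-true⇒ (adjacent? (kind x) (kind y))

  Adjacent⇒E : ∀ {x y} → Adjacent (kind x) (kind y) → E x y ≡ true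
  Adjacent⇒E {x} {y} = dec-true (adjacent? (kind x) (kind y))

  E-vertexAt : ∀ {u v} → Adjacent u v → E (vertexAt u) (vertexAt v) ≡ true
  E-vertexAt {u} {v} adj =
    Adjacent⇒E (subst₂ Adjacent (sym (kind-vertexAt u)) (sym (kind-vertexAt v)) adj)

  isSimpleUndirected : IsSimpleUndirected E
  isSimpleUndirected = record
    { sym    = λ _ _ e → Adjacent⇒E (Adjacent-sym (E⇒Adjacent e))
    ; irrefl = λ u → dec-false (adjacent? (kind u) (kind u)) Adjacent-irrefl
    }

  T : Subset size
  T = ⊤ {a + b} ++ ⊥ {a * b}

  ∣T∣≡a+b : ∣ T ∣ ≡ a + b
  ∣T∣≡a+b = trans (∣⊤++p∣ (a + b) ⊥) (trans (cong (a + b +_) (∣⊥∣≡0 (a * b))) (+-identityʳ (a + b)))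

  terminal∈T : ∀ u → vertexAt (inj₁ u) ∈ T
  terminal∈T u = lookup⇒[]= _ T
    (trans (lookup-++ˡ ⊤ (⊥ {a * b}) (join a b u)) (lookup-replicate (join a b u) true))

  mid∉T : ∀ i j → M i j ∉ T
  mid∉T i j M∈T
    with trans (sym ([]=⇒lookup M∈T))
               (trans (lookup-++ʳ (⊤ {a + b}) ⊥ (combine i j)) (lookup-replicate (combine i j) _))
  ... | ()

  quasiBipartite : QuasiBipartite E T
  quasiBipartite u v e with Adjacent-terminal (E⇒Adjacent e)
  ... | inj₁ (w , eq) = inj₁ (subst (_∈ T) (sym (kind≡⇒≡vertexAt eq)) (terminal∈T w))
  ... | inj₂ (w , eq) = inj₂ (subst (_∈ T) (sym (kind≡⇒≡vertexAt eq)) (terminal∈T w))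

  module _ (i : Fin a) (j : Fin b) where

    A B S : Subset size
    A = T - R j
    B = T - L i
    S = B - R j

    A⊆T : A ⊆ T
    A⊆T = p─q⊆p T _

    B⊆T : B ⊆ T
    B⊆T = p─q⊆p T _

    S⊆B : S ⊆ B
    S⊆B = p─q⊆p B _

    S⊆A : S ⊆ A
    S⊆A x∈S = x∈p∧x≢y⇒x∈p-y (B⊆T (S⊆B x∈S)) (x∈p-y⇒x≢y x∈S)

    L∈A : L i ∈ A
    L∈A = x∈p∧x≢y⇒x∈p-y (terminal∈T (inj₁ i)) L≢R

    R∈B : R j ∈ B
    R∈B = x∈p∧x≢y⇒x∈p-y (terminal∈T (inj₂ j)) (λ eq → L≢R (sym eq))

    A∖S≡L : ∀ {x} → x ∈ A → x ∉ S → x ≡ L i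
    A∖S≡L {x} x∈A x∉S with x ≟ L i
    ... | yes x≡L = x≡L
    ... | no  x≢L = ⊥-elim (x∉S (x∈p∧x≢y⇒x∈p-y (x∈p∧x≢y⇒x∈p-y (A⊆T x∈A) x≢L) (x∈p-y⇒x≢y x∈A)))

    B∖S≡R : ∀ {x} → x ∈ B → x ∉ S → x ≡ R j
    B∖S≡R {x} x∈B x∉S with x ≟ R j
    ... | yes x≡R = x≡R
    ... | no  x≢R = ⊥-elim (x∉S (x∈p∧x≢y⇒x∈p-y x∈B x≢R))

    S⊂cut : ∀ {C} → IsVertexCut ⊤ E A B C → S ⊂ C
    S⊂cut {C} cut@(_ , separates) = (λ x∈S → ∩⊆cut cut (S⊆A x∈S) (S⊆B x∈S)) , path-meets-C
      where
        path-meets-C : ∃[ y ] (y ∈ C × y ∉ S)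
        path-meets-C with L i ∈? C | M i j ∈? C | R j ∈? C
        ... | yes L∈C | _       | _       = L i , L∈C , λ L∈S → x∈p-y⇒x≢y (S⊆B L∈S) refl
        ... | _       | yes M∈C | _       = M i j , M∈C , λ M∈S → mid∉T i j (B⊆T (S⊆B M∈S))
        ... | _       | _       | yes R∈C = R j , R∈C , λ R∈S → x∈p-y⇒x≢y R∈S refl
        ... | no L∉C  | no M∉C  | no R∉C  = ⊥-elim (separates _ _ L∈A L∉C R∈B R∉C
                 (step L∉C (E-vertexAt (left-mid i j)) (step M∉C (E-vertexAt (mid-right i j)) (here R∉C))))

    mincut-G : IsMinCut ⊤ E A B ∣ B ∣
    mincut-G = (B , ((λ _ → ∈⊤) , λ _ _ _ _ x∈B x∉B _ → x∉B x∈B) , refl)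
             , λ C cut → ≤-trans (∣p∣≤1+∣p-x∣ B (R j)) (p⊂q⇒∣p∣<∣q∣ (S⊂cut cut))

    module _ (H : Subgraph E) (T⊆V' : T ⊆ V' H) (M∉V' : M i j ∉ V' H) where

      -- What L i can reach in H after deleting S: itself and the surviving M i j′.
      ReachedFromL : Fin size → Set
      ReachedFromL x = kind x ≡ left i ⊎ ∃[ j′ ] (kind x ≡ mid i j′ × j′ ≢ j)

      ReachedFromL-closed : ∀ {x z} → ReachedFromL x → E' H x z ≡ true → z ∉ S → ReachedFromL z
      ReachedFromL-closed {x} {z} (inj₁ x≡L) e z∉S
        with Adjacent-left (subst (λ v → Adjacent v (kind z)) x≡L (E⇒Adjacent (E'⊆E H x z e)))
      ... | j′ , z≡M = inj₂ (j′ , z≡M , λ { refl →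
              M∉V' (subst (_∈ V' H) (kind≡⇒≡vertexAt z≡M) (E'-endr H x z e)) })
      ReachedFromL-closed {x} {z} (inj₂ (j′ , x≡M , j′≢j)) e z∉S
        with Adjacent-mid (subst (λ v → Adjacent v (kind z)) x≡M (E⇒Adjacent (E'⊆E H x z e)))
      ... | inj₁ z≡L = inj₁ z≡L
      ... | inj₂ z≡R = ⊥-elim (z∉S (subst (_∈ S) (sym (kind≡⇒≡vertexAt z≡R)) R′∈S))
        where R′∈S : R j′ ∈ S
              R′∈S = x∈p∧x≢y⇒x∈p-y (x∈p∧x≢y⇒x∈p-y (terminal∈T (inj₂ j′)) (λ eq → L≢R (sym eq)))
                                   (λ eq → j′≢j (R-injective eq))

      R-unreached : ¬ ReachedFromL (R j)
      R-unreached (inj₁ R≡L) with trans (sym (kind-vertexAt (right j))) R≡L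
      ... | ()
      R-unreached (inj₂ (_ , R≡M , _)) with trans (sym (kind-vertexAt (right j))) R≡M
      ... | ()

      S-separates-H : IsVertexCut (V' H) (E' H) A B S
      S-separates-H = (λ x∈S → T⊆V' (B⊆T (S⊆B x∈S))) , λ x y x∈A x∉S y∈B y∉S path →
        R-unreached (subst ReachedFromL (B∖S≡R y∈B y∉S)
          (PathAvoiding-preserves ReachedFromL ReachedFromL-closed
            (subst ReachedFromL (sym (A∖S≡L x∈A x∉S)) (inj₁ (kind-vertexAt (left i)))) path))

    mid∈sparsifier : ∀ H → IsVertexCutSparsifier E T H → M i j ∈ V' H
    mid∈sparsifier H sparsifier@(T⊆V' , _) with M i j ∈? V' H
    ... | yes M∈V' = M∈V'
    ... | no  M∉V' = ⊥-elim (<⇒≱ (x∈p⇒∣p-x∣<∣p∣ {p = B} R∈B)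
            (sparsifier-mincut≤cut {E = E} {T} {H} sparsifier A⊆T B⊆T mincut-G (S-separates-H H T⊆V' M∉V')))

  sparsifier-spans : ∀ H → IsVertexCutSparsifier E T H → ∀ x → x ∈ V' H
  sparsifier-spans H sparsifier x = subst (_∈ V' H) (vertexAt-kind x) (spans (kind x))
    where spans : ∀ v → vertexAt v ∈ V' H
          spans (inj₁ u)  = proj₁ sparsifier (terminal∈T u)
          spans (mid i j) = mid∈sparsifier i j H sparsifier

  size≤sparsifier : ∀ H → IsVertexCutSparsifier E T H → size ≤ ∣ V' H ∣
  size≤sparsifier H sparsifier =
    subst (_≤ ∣ V' H ∣) (∣⊤∣≡n size) (p⊆q⇒∣p∣≤∣q∣ {p = ⊤} λ {x} _ → sparsifier-spans H sparsifier x)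

balanced-split : ∀ k → ∃[ a ] ∃[ b ] (a + b ≡ k × (b ≡ a ⊎ b ≡ suc a))
balanced-split zero = 0 , 0 , refl , inj₁ refl
balanced-split (suc k) with balanced-split k
... | a , .a       , a+a≡k , inj₁ refl = a , suc a , trans (+-suc a a) (cong suc a+a≡k) , inj₂ refl
... | a , .(suc a) , a+b≡k , inj₂ refl = suc a , suc a , cong suc a+b≡k , inj₁ refl

balanced-square≤4*size : ∀ a b → (b ≡ a ⊎ b ≡ suc a) → (a + b) * (a + b) ≤ 4 * ((a + b) + a * b)
balanced-square≤4*size a .a (inj₁ refl) = ≤-trans (m≤m+n ((a + a) * (a + a)) (4 * (a + a))) (≤-reflexive (sym eq))
  where eq : 4 * ((a + a) + a * a) ≡ (a + a) * (a + a) + 4 * (a + a)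
        eq = solve 1 (λ a → con 4 :* ((a :+ a) :+ a :* a) := (a :+ a) :* (a :+ a) :+ con 4 :* (a :+ a)) refl a
          where open +-*-Solver
balanced-square≤4*size a .(suc a) (inj₂ refl) = ≤-trans (m≤m+n ((a + suc a) * (a + suc a)) (8 * a + 3)) (≤-reflexive (sym eq))
  where eq : 4 * ((a + suc a) + a * suc a) ≡ (a + suc a) * (a + suc a) + (8 * a + 3)
        eq = solve 1 (λ a → con 4 :* ((a :+ (con 1 :+ a)) :+ a :* (con 1 :+ a))
                         := (a :+ (con 1 :+ a)) :* (a :+ (con 1 :+ a)) :+ (con 8 :* a :+ con 3)) refl a
          where open +-*-Solver

theorem1p4 : ∃[ d ] (d > 0 ×
               (∀ (k : ℕ) → ∃[ n ] Σ (Edges n) λ E → Σ (Subset n) λ T →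
                  IsSimpleUndirected E × QuasiBipartite E T × ∣ T ∣ ≡ k ×
                  (∀ (H : Subgraph E) → IsVertexCutSparsifier E T H →
                     k * k ≤ d * ∣ V' H ∣)))
theorem1p4 = 4 , s≤s z≤n , hardInstance
  where
    hardInstance : ∀ k → ∃[ n ] Σ (Edges n) λ E → Σ (Subset n) λ T →
                     IsSimpleUndirected E × QuasiBipartite E T × ∣ T ∣ ≡ k ×
                     (∀ (H : Subgraph E) → IsVertexCutSparsifier E T H → k * k ≤ 4 * ∣ V' H ∣)
    hardInstance k with balanced-split k
    ... | a , b , refl , balanced =
      size , E , T , isSimpleUndirected , quasiBipartite , ∣T∣≡a+b ,
      λ H sparsifier → ≤-trans (balanced-square≤4*size a b balanced)
                               (*-monoʳ-≤ 4 (size≤sparsifier H sparsifier))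
      where open SubdividedBiclique a b
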